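{- Let $H$ be a hypergraph with at least one hyperedge and let $\sigma$ be a minimum sum set cover of $H$. Then $r_\sigma(1)\ge |E(H)|/\tau(H)$.
   Context: A hypergraph $H$ has finite vertex set $V(H)$ and a set $E(H)$ of nonempty subsets of $V(H)$. A set cover is a set of vertices meeting every hyperedge; $\tau(H)$ is the minimum size of a set cover. An ordering of $H$ is a bijection $\sigma:V(H)\to\{1,\dots,|V(H)|\}$; its cost is $\sum_{e\in E(H)}\min_{v\in e}\sigma(v)$. A minimum sum set cover of $H$ is an ordering of minimum cost. The effective coverage of position $i$ is $r_\sigma(i)=|\{e\in E(H): \min_{v\in e}\sigma(v)=i\}|$. -}

module Defs where

open import Data.Nat using (ℕ; zero; suc; _⊓_; _≤_; _*_; _≟_)
open import Data.Fin using (Fin; toℕ)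
open import Data.Fin.Subset using (Subset; _∈_; Nonempty; ∣_∣)
open import Data.Fin.Subset.Properties using (_∈?_)
open import Data.Fin.Permutation using (Permutation′)
open import Data.List using (List; allFin; foldr; map; length; filter)
open import Data.Nat.ListAction using (sum)
open import Data.Product using (∃; _×_)
open import Function.Definitions using (Injective)
open import Function.Bundles using (Inverse)
open import Relation.Binary.PropositionalEquality using (_≡_)
open import Relation.Nullary using (does)
open import Data.Bool using (if_then_else_)

-- The hyperedges are
-- given by an injective family (so E(H) is a *set* of m distinct subsets),
-- and each hyperedge is a nonempty subset of the vertices.
record Hypergraph : Set where
  field
    n             : ℕ
    m             : ℕ
    edge          : Fin m → Subset n
    edge-injective : Injective _≡_ _≡_ edge
    edge-nonempty  : ∀ j → Nonempty (edge j)
open Hypergraph public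

-- An ordering: a bijection V(H) → positions.  Position of vertex v is
-- 1 + toℕ (σ v), so positions range over {1, …, |V(H)|}.
Ordering : Hypergraph → Set
Ordering H = Permutation′ (n H)

pos : (H : Hypergraph) → Ordering H → Fin (n H) → ℕ
pos H σ v = suc (toℕ (Inverse.to σ v))

-- min_{v ∈ e} σ(v).  The initial value suc n exceeds every position, so for a
-- nonempty e this is exactly the minimum position of a vertex of e.
minPos : (H : Hypergraph) → Ordering H → Subset (n H) → ℕ
minPos H σ e =
  foldr (λ v acc → if does (v ∈? e) then pos H σ v ⊓ acc else acc)
        (suc (n H)) (allFin (n H))

cost : (H : Hypergraph) → Ordering H → ℕ
cost H σ = sum (map (λ j → minPos H σ (edge H j)) (allFin (m H)))

IsMSSC : (H : Hypergraph) → Ordering H → Set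
IsMSSC H σ = ∀ (σ′ : Ordering H) → cost H σ ≤ cost H σ′

r : (H : Hypergraph) → Ordering H → ℕ → ℕ
r H σ i = length (filter (λ j → minPos H σ (edge H j) ≟ i) (allFin (m H)))

IsSetCover : (H : Hypergraph) → Subset (n H) → Set
IsSetCover H S = ∀ j → ∃ λ v → v ∈ S × v ∈ edge H j

IsTau : Hypergraph → ℕ → Set
IsTau H t = (∃ λ S → IsSetCover H S × ∣ S ∣ ≡ t)
          × (∀ S → IsSetCover H S → t ≤ ∣ S ∣)

module Submission where

-- Let c(e) be the position at which e is first covered and ρ = r_σ(1).
-- Exchanging the vertices at positions 1 and k + 1 raises the cost by at most k·(r_σ(1) − r_σ(k + 1)),
-- so in an optimal ordering every level k has r_σ(k) ≤ ρ; hence at most kρ edges have c(e) ≤ k,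
-- which forces 2·cost(σ) ≥ 2(t + 1)m − ρ t(t + 1).  Conversely, putting the t vertices of a
-- minimum cover first, once in some order and once in the reverse order, gives two orderings in
-- which the two positions covering any edge add up to at most t + 1, so 2·cost(σ) ≤ (t + 1)m.
-- Comparing the two bounds gives m ≤ ρ t.

open import Algebra.Properties.CommutativeSemigroup using (interchange)
open import Data.Bool using (true; false; if_then_else_)
open import Data.Fin as Fin using (Fin; toℕ; fromℕ<)
open import Data.Fin.Permutation using (Permutation′; _⟨$⟩ʳ_; _∘ₚ_; transpose; insert; id)
import Data.Fin.Permutation.Components as PC
open import Data.Fin.Properties using (toℕ-injective; toℕ<n; toℕ-fromℕ<)
open import Data.Fin.Subset using (Subset; _∈_; Nonempty; ∣_∣)
open import Data.Fin.Subset.Properties using (_∈?_)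
open import Data.List using (List; []; _∷_; [_]; _++_; map; foldr; length; filter; reverse; allFin)
open import Data.List.Membership.Propositional using () renaming (_∈_ to _∈ₗ_)
open import Data.List.Membership.Propositional.Properties using (∈-allFin; ∈-∃++; ∈-map⁺)
open import Data.List.Properties
  using (map-cong; length-map; length-tabulate; length-reverse; length-++; reverse-++; unfold-reverse; ++-assoc)
open import Data.List.Relation.Unary.Any using (here; there)
open import Data.Nat using (ℕ; zero; suc; _+_; _*_; _∸_; _⊓_; _≤_; _<_; _≥_; z≤n; s≤s)
open import Data.Nat.ListAction using (sum)
open import Data.Nat.Properties
open import Data.Nat.Solver using (module +-*-Solver)
open import Data.Product using (∃; _×_; _,_)
open import Data.Sum using (_⊎_; inj₁; inj₂)
open import Data.Vec using ([]; _∷_; here; there)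
open import Function using (_∘_)
open import Relation.Binary.PropositionalEquality
  using (_≡_; _≢_; refl; sym; trans; cong; cong₂; subst; module ≡-Reasoning)
open import Relation.Nullary using (Dec; does; _because_; yes; no; ¬_)
open import Relation.Nullary.Negation using (contradiction)
open import Relation.Unary using (Pred; Decidable)

open import Defs

∑ : {A : Set} → List A → (A → ℕ) → ℕ
∑ xs f = sum (map f xs)

syntax ∑ xs (λ x → e) = ∑[ x ∈ xs ] e

module _ {A : Set} where

  ∑-cong : ∀ xs {f g : A → ℕ} → (∀ x → f x ≡ g x) → ∑ xs f ≡ ∑ xs g
  ∑-cong xs f≗g = cong sum (map-cong f≗g xs)

  ∑-mono : ∀ xs {f g : A → ℕ} → (∀ x → f x ≤ g x) → ∑ xs f ≤ ∑ xs g
  ∑-mono []       f≤g = z≤n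
  ∑-mono (x ∷ xs) f≤g = +-mono-≤ (f≤g x) (∑-mono xs f≤g)

  ∑-+ : ∀ xs (f g : A → ℕ) → ∑[ x ∈ xs ] (f x + g x) ≡ ∑ xs f + ∑ xs g
  ∑-+ []       f g = refl
  ∑-+ (x ∷ xs) f g = trans (cong (f x + g x +_) (∑-+ xs f g)) (interchange +-commutativeSemigroup (f x) (g x) _ _)

  ∑-*ˡ : ∀ xs k (f : A → ℕ) → ∑[ x ∈ xs ] (k * f x) ≡ k * ∑ xs f
  ∑-*ˡ []       k f = sym (*-zeroʳ k)
  ∑-*ˡ (x ∷ xs) k f = trans (cong (k * f x +_) (∑-*ˡ xs k f)) (sym (*-distribˡ-+ k (f x) (∑ xs f)))

  ∑-+-*ˡ : ∀ xs k (f g : A → ℕ) → ∑[ x ∈ xs ] (f x + k * g x) ≡ ∑ xs f + k * ∑ xs g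
  ∑-+-*ˡ xs k f g = trans (∑-+ xs f (λ x → k * g x)) (cong (∑ xs f +_) (∑-*ˡ xs k g))

  ∑-const : ∀ (xs : List A) k → ∑[ x ∈ xs ] k ≡ length xs * k
  ∑-const []       k = refl
  ∑-const (x ∷ xs) k = cong (k +_) (∑-const xs k)

  ∑-zero : ∀ xs {f : A → ℕ} → (∀ x → f x ≡ 0) → ∑ xs f ≡ 0
  ∑-zero xs f≗0 = trans (∑-cong xs f≗0) (trans (∑-const xs 0) (*-zeroʳ (length xs)))

-- Defined through `does` alone, so that 𝟙 (m ≤? n) and 𝟙 (m ≟ n) compute on zero and suc.
𝟙 : {P : Set} → Dec P → ℕ
𝟙 p? = if does p? then 1 else 0

𝟙-true : {P : Set} (p? : Dec P) → P → 𝟙 p? ≡ 1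
𝟙-true (yes _) _ = refl
𝟙-true (no ¬p) p = contradiction p ¬p

𝟙-false : {P : Set} (p? : Dec P) → ¬ P → 𝟙 p? ≡ 0
𝟙-false (yes p) ¬p = contradiction p ¬p
𝟙-false (no _)  _  = refl

length-filter≡∑𝟙 : {A : Set} {P : Pred A _} (P? : Decidable P) (xs : List A) →
                   length (filter P? xs) ≡ ∑[ x ∈ xs ] 𝟙 (P? x)
length-filter≡∑𝟙 P? []       = refl
length-filter≡∑𝟙 P? (x ∷ xs) with P? x
... | true  because _ = cong suc (length-filter≡∑𝟙 P? xs)
... | false because _ = length-filter≡∑𝟙 P? xs

𝟙-≤-suc : ∀ x T → 𝟙 (x ≤? suc T) ≡ 𝟙 (x ≤? T) + 𝟙 (x ≟ suc T)
𝟙-≤-suc zero          T       = refl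
𝟙-≤-suc (suc zero)    zero    = refl
𝟙-≤-suc (suc (suc x)) zero    = refl
𝟙-≤-suc (suc zero)    (suc T) = refl
𝟙-≤-suc (suc (suc x)) (suc T) = 𝟙-≤-suc (suc x) T

suc∸≡∸+𝟙 : ∀ T {c} → 0 < c → suc T ∸ c ≡ (T ∸ c) + 𝟙 (c ≤? T)
suc∸≡∸+𝟙 zero    {suc zero}    _ = refl
suc∸≡∸+𝟙 zero    {suc (suc c)} _ = refl
suc∸≡∸+𝟙 (suc T) {suc zero}    _ = +-comm 1 T
suc∸≡∸+𝟙 (suc T) {suc (suc c)} _ = suc∸≡∸+𝟙 T {suc c} (s≤s z≤n)

module _ {A : Set} (xs : List A) (c : A → ℕ) (c-positive : ∀ a → 0 < c a)
         {ρ : ℕ} (level-≤ : ∀ k → ∑[ a ∈ xs ] 𝟙 (c a ≟ k) ≤ ρ) where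

  ∑𝟙-≤-level : ∀ T → ∑[ a ∈ xs ] 𝟙 (c a ≤? T) ≤ T * ρ
  ∑𝟙-≤-level zero    = ≤-reflexive (∑-zero xs λ a → 𝟙-false (c a ≤? 0) (<⇒≱ (c-positive a)))
  ∑𝟙-≤-level (suc T) = begin
    ∑[ a ∈ xs ] 𝟙 (c a ≤? suc T)                            ≡⟨ ∑-cong xs (λ a → 𝟙-≤-suc (c a) T) ⟩
    ∑[ a ∈ xs ] (𝟙 (c a ≤? T) + 𝟙 (c a ≟ suc T))            ≡⟨ ∑-+ xs (λ a → 𝟙 (c a ≤? T)) (λ a → 𝟙 (c a ≟ suc T)) ⟩
    ∑[ a ∈ xs ] 𝟙 (c a ≤? T) + ∑[ a ∈ xs ] 𝟙 (c a ≟ suc T) ≤⟨ +-mono-≤ (∑𝟙-≤-level T) (level-≤ (suc T)) ⟩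
    T * ρ + ρ                                               ≡⟨ +-comm (T * ρ) ρ ⟩
    suc T * ρ                                               ∎
    where open ≤-Reasoning

  ∑∸-≤ : ∀ t → 2 * ∑[ a ∈ xs ] (suc t ∸ c a) ≤ ρ * (suc t * t)
  ∑∸-≤ zero    = ≤-trans (≤-reflexive (cong (2 *_) (∑-zero xs λ a → m≤n⇒m∸n≡0 (c-positive a)))) z≤n
  ∑∸-≤ (suc t) = begin
    2 * ∑[ a ∈ xs ] (suc (suc t) ∸ c a)                          ≡⟨ cong (2 *_) (∑-cong xs λ a → suc∸≡∸+𝟙 (suc t) (c-positive a)) ⟩
    2 * ∑[ a ∈ xs ] ((suc t ∸ c a) + 𝟙 (c a ≤? suc t))          ≡⟨ cong (2 *_) (∑-+ xs (λ a → suc t ∸ c a) (λ a → 𝟙 (c a ≤? suc t))) ⟩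
    2 * (∑[ a ∈ xs ] (suc t ∸ c a) + ∑[ a ∈ xs ] 𝟙 (c a ≤? suc t))
      ≡⟨ *-distribˡ-+ 2 (∑[ a ∈ xs ] (suc t ∸ c a)) (∑[ a ∈ xs ] 𝟙 (c a ≤? suc t)) ⟩
    2 * ∑[ a ∈ xs ] (suc t ∸ c a) + 2 * ∑[ a ∈ xs ] 𝟙 (c a ≤? suc t)
      ≤⟨ +-mono-≤ (∑∸-≤ t) (*-monoʳ-≤ 2 (∑𝟙-≤-level (suc t))) ⟩
    ρ * (suc t * t) + 2 * (suc t * ρ)                            ≡⟨ solve 2 (λ ρ t → ρ :* ((con 1 :+ t) :* t) :+ con 2 :* ((con 1 :+ t) :* ρ)
                                                                          := ρ :* ((con 2 :+ t) :* (con 1 :+ t))) refl ρ t ⟩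
    ρ * (suc (suc t) * suc t)                                    ∎
    where open ≤-Reasoning
          open +-*-Solver

  ∑-≥-by-levels : ∀ t → 2 * (suc t * length xs) ≤ 2 * ∑ xs c + ρ * (suc t * t)
  ∑-≥-by-levels t = begin
    2 * (suc t * length xs)                          ≡⟨ cong (2 *_) (trans (*-comm (suc t) (length xs)) (sym (∑-const xs (suc t)))) ⟩
    2 * ∑[ a ∈ xs ] suc t                            ≤⟨ *-monoʳ-≤ 2 (∑-mono xs λ a → m≤n+m∸n (suc t) (c a)) ⟩
    2 * ∑[ a ∈ xs ] (c a + (suc t ∸ c a))            ≡⟨ cong (2 *_) (∑-+ xs c (λ a → suc t ∸ c a)) ⟩
    2 * (∑ xs c + ∑[ a ∈ xs ] (suc t ∸ c a))         ≡⟨ *-distribˡ-+ 2 (∑ xs c) (∑[ a ∈ xs ] (suc t ∸ c a)) ⟩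
    2 * ∑ xs c + 2 * ∑[ a ∈ xs ] (suc t ∸ c a)       ≤⟨ +-monoʳ-≤ (2 * ∑ xs c) (∑∸-≤ t) ⟩
    2 * ∑ xs c + ρ * (suc t * t)                     ∎
    where open ≤-Reasoning

transpose-matchˡ : ∀ {n} (i j : Fin n) → PC.transpose i j i ≡ j
transpose-matchˡ i j with i Fin.≟ i
... | yes _  = refl
... | no i≢i = contradiction refl i≢i

transpose-matchʳ : ∀ {n} (i j : Fin n) → PC.transpose i j j ≡ i
transpose-matchʳ i j with j Fin.≟ i
... | yes j≡i = j≡i
... | no _ with j Fin.≟ j
...   | yes _  = refl
...   | no j≢j = contradiction refl j≢j

transpose-mismatch : ∀ {n} {i j k : Fin n} → k ≢ i → k ≢ j → PC.transpose i j k ≡ k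
transpose-mismatch {i = i} {j} {k} k≢i k≢j with k Fin.≟ i
... | yes k≡i = contradiction k≡i k≢i
... | no _ with k Fin.≟ j
...   | yes k≡j = contradiction k≡j k≢j
...   | no _    = refl

n+n*0≡n*1 : ∀ n → n + n * 0 ≡ n * 1
n+n*0≡n*1 n = trans (cong (n +_) (*-zeroʳ n)) (trans (+-identityʳ n) (sym (*-identityʳ n)))

-- Swapping position 0 with position toℕ j moves one vertex toℕ j places back and one toℕ j places
-- forward; the identity is stated additively to avoid truncated subtraction.
toℕ-transpose-first : ∀ {n} {i j : Fin n} → toℕ i ≡ 0 → 0 < toℕ j → ∀ k →
  toℕ (PC.transpose i j k) + toℕ j * 𝟙 (toℕ k ≟ toℕ j) ≡ toℕ k + toℕ j * 𝟙 (toℕ k ≟ 0)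
toℕ-transpose-first {i = i} {j} i₀ j>0 k = by-cases (k Fin.≟ i) (k Fin.≟ j)
  where
    by-cases : Dec (k ≡ i) → Dec (k ≡ j) →
      toℕ (PC.transpose i j k) + toℕ j * 𝟙 (toℕ k ≟ toℕ j) ≡ toℕ k + toℕ j * 𝟙 (toℕ k ≟ 0)
    by-cases (yes refl) _
      rewrite transpose-matchˡ k j | i₀ | 𝟙-false (0 ≟ toℕ j) (<⇒≢ j>0) = n+n*0≡n*1 (toℕ j)
    by-cases (no _) (yes refl)
      rewrite transpose-matchʳ i k | i₀ | 𝟙-true (toℕ k ≟ toℕ k) refl | 𝟙-false (toℕ k ≟ 0) (>⇒≢ j>0)
      = sym (n+n*0≡n*1 (toℕ k))
    by-cases (no k≢i) (no k≢j)
      rewrite transpose-mismatch k≢i k≢j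
            | 𝟙-false (toℕ k ≟ toℕ j) (k≢j ∘ toℕ-injective)
            | 𝟙-false (toℕ k ≟ 0) (λ k₀ → k≢i (toℕ-injective (trans k₀ (sym i₀)))) = refl

toℕ-punchOut-≤ : ∀ {n} {i j : Fin (suc n)} (i≢j : i ≢ j) → toℕ (Fin.punchOut i≢j) ≤ toℕ j
toℕ-punchOut-≤ {_}     {Fin.zero}  {Fin.zero}  i≢j = contradiction refl i≢j
toℕ-punchOut-≤ {_}     {Fin.zero}  {Fin.suc j} _   = n≤1+n (toℕ j)
toℕ-punchOut-≤ {suc _} {Fin.suc i} {Fin.zero}  _   = z≤n
toℕ-punchOut-≤ {suc _} {Fin.suc i} {Fin.suc j} i≢j = s≤s (toℕ-punchOut-≤ (i≢j ∘ cong Fin.suc))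

moveToFront : ∀ {n} → Fin n → Permutation′ n → Permutation′ n
moveToFront {suc _} x τ = τ ∘ₚ insert (τ ⟨$⟩ʳ x) Fin.zero id

moveToFront-self : ∀ {n} (x : Fin n) τ → toℕ (moveToFront x τ ⟨$⟩ʳ x) ≡ 0
moveToFront-self {suc _} x τ with τ ⟨$⟩ʳ x Fin.≟ τ ⟨$⟩ʳ x
... | yes _ = refl
... | no p≢p = contradiction refl p≢p

moveToFront-≤ : ∀ {n} (x : Fin n) τ v → toℕ (moveToFront x τ ⟨$⟩ʳ v) ≤ suc (toℕ (τ ⟨$⟩ʳ v))
moveToFront-≤ {suc _} x τ v with τ ⟨$⟩ʳ x Fin.≟ τ ⟨$⟩ʳ v
... | yes _ = z≤n
... | no p≢q = s≤s (toℕ-punchOut-≤ p≢q)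

moveAllToFront : ∀ {n} → List (Fin n) → Permutation′ n
moveAllToFront []       = id
moveAllToFront (x ∷ xs) = moveToFront x (moveAllToFront xs)

moveAllToFront-++-∷ : ∀ {n} ys (v : Fin n) zs → toℕ (moveAllToFront (ys ++ v ∷ zs) ⟨$⟩ʳ v) ≤ length ys
moveAllToFront-++-∷ []       v zs = ≤-reflexive (moveToFront-self v (moveAllToFront zs))
moveAllToFront-++-∷ (y ∷ ys) v zs =
  ≤-trans (moveToFront-≤ y (moveAllToFront (ys ++ v ∷ zs)) v) (s≤s (moveAllToFront-++-∷ ys v zs))

reverse-++-∷ : ∀ {A : Set} (ys : List A) v zs → reverse (ys ++ v ∷ zs) ≡ reverse zs ++ v ∷ reverse ys
reverse-++-∷ ys v zs = begin
  reverse (ys ++ v ∷ zs)              ≡⟨ reverse-++ ys (v ∷ zs) ⟩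
  reverse (v ∷ zs) ++ reverse ys      ≡⟨ cong (_++ reverse ys) (unfold-reverse v zs) ⟩
  (reverse zs ++ [ v ]) ++ reverse ys ≡⟨ ++-assoc (reverse zs) [ v ] (reverse ys) ⟩
  reverse zs ++ v ∷ reverse ys        ∎
  where open ≡-Reasoning

moveAllToFront-reverse : ∀ {n} {v : Fin n} {vs} → v ∈ₗ vs →
  toℕ (moveAllToFront vs ⟨$⟩ʳ v) + toℕ (moveAllToFront (reverse vs) ⟨$⟩ʳ v) < length vs
moveAllToFront-reverse {v = v} v∈vs with ∈-∃++ v∈vs
... | ys , zs , refl = begin-strict
  toℕ (moveAllToFront (ys ++ v ∷ zs) ⟨$⟩ʳ v) + toℕ (moveAllToFront (reverse (ys ++ v ∷ zs)) ⟨$⟩ʳ v)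
    ≤⟨ +-mono-≤ (moveAllToFront-++-∷ ys v zs)
                (subst (λ ws → toℕ (moveAllToFront ws ⟨$⟩ʳ v) ≤ length zs) (sym (reverse-++-∷ ys v zs))
                       (≤-trans (moveAllToFront-++-∷ (reverse zs) v (reverse ys)) (≤-reflexive (length-reverse zs)))) ⟩
  length ys + length zs
    <⟨ ≤-reflexive (sym (+-suc (length ys) (length zs))) ⟩
  length ys + length (v ∷ zs)
    ≡⟨ length-++ ys ⟨
  length (ys ++ v ∷ zs) ∎
  where open ≤-Reasoning

elements : ∀ {n} → Subset n → List (Fin n)
elements []          = []
elements (true ∷ p)  = Fin.zero ∷ map Fin.suc (elements p)
elements (false ∷ p) = map Fin.suc (elements p)

length-elements : ∀ {n} (p : Subset n) → length (elements p) ≡ ∣ p ∣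
length-elements []          = refl
length-elements (true ∷ p)  = cong suc (trans (length-map Fin.suc (elements p)) (length-elements p))
length-elements (false ∷ p) = trans (length-map Fin.suc (elements p)) (length-elements p)

∈-elements : ∀ {n} {p : Subset n} {v} → v ∈ p → v ∈ₗ elements p
∈-elements {p = true ∷ p}  {Fin.zero}  here        = here refl
∈-elements {p = true ∷ p}  {Fin.suc v} (there v∈p) = there (∈-map⁺ Fin.suc (∈-elements v∈p))
∈-elements {p = false ∷ p} {Fin.suc v} (there v∈p) = ∈-map⁺ Fin.suc (∈-elements v∈p)

module _ (H : Hypergraph) (σ : Ordering H) (e : Subset (n H)) where

  private
    minPosOver : List (Fin (n H)) → ℕ
    minPosOver = foldr (λ v acc → if does (v ∈? e) then pos H σ v ⊓ acc else acc) (suc (n H))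

    minPosOver-≤ : ∀ {v vs} → v ∈ₗ vs → v ∈ e → minPosOver vs ≤ pos H σ v
    minPosOver-≤ {v} (here refl) v∈e with v ∈? e
    ... | yes _   = m⊓n≤m _ _
    ... | no v∉e = contradiction v∈e v∉e
    minPosOver-≤ {vs = w ∷ _} (there v∈vs) v∈e with w ∈? e
    ... | yes _ = ≤-trans (m⊓n≤n _ _) (minPosOver-≤ v∈vs v∈e)
    ... | no _  = minPosOver-≤ v∈vs v∈e

    minPosOver-attained : ∀ vs → minPosOver vs ≡ suc (n H) ⊎ ∃ λ w → w ∈ e × minPosOver vs ≡ pos H σ w
    minPosOver-attained []       = inj₁ refl
    minPosOver-attained (v ∷ vs) with v ∈? e
    ... | no _    = minPosOver-attained vs
    ... | yes v∈e with ⊓-sel (pos H σ v) (minPosOver vs)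
    ...   | inj₁ ≡pos-v = inj₂ (v , v∈e , ≡pos-v)
    ...   | inj₂ ≡rest  rewrite ≡rest = minPosOver-attained vs

  minPos-≤-pos : ∀ {v} → v ∈ e → minPos H σ e ≤ pos H σ v
  minPos-≤-pos v∈e = minPosOver-≤ (∈-allFin _) v∈e

  minPos-attained : Nonempty e → ∃ λ w → w ∈ e × minPos H σ e ≡ pos H σ w
  minPos-attained (v , v∈e) with minPosOver-attained (allFin (n H))
  ... | inj₂ attained = attained
  ... | inj₁ ≡1+n     = contradiction (subst (_≤ n H) ≡1+n (≤-trans (minPos-≤-pos v∈e) (toℕ<n _))) 1+n≰n

minPos-edge-is-position : ∀ H σ a → ∃ λ (p : Fin (n H)) → minPos H σ (edge H a) ≡ suc (toℕ p)
minPos-edge-is-position H σ a with minPos-attained H σ (edge H a) (edge-nonempty H a)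
... | w , _ , ≡pos-w = σ ⟨$⟩ʳ w , ≡pos-w

minPos-edge-positive : ∀ H σ a → 0 < minPos H σ (edge H a)
minPos-edge-positive H σ a with minPos-edge-is-position H σ a
... | _ , ≡1+p rewrite ≡1+p = s≤s z≤n

r≡∑𝟙 : ∀ H σ k → r H σ k ≡ ∑[ a ∈ allFin (m H) ] 𝟙 (minPos H σ (edge H a) ≟ k)
r≡∑𝟙 H σ k = length-filter≡∑𝟙 (λ a → minPos H σ (edge H a) ≟ k) (allFin (m H))

r≡0 : ∀ H σ {k} → (∀ a → minPos H σ (edge H a) ≢ k) → r H σ k ≡ 0
r≡0 H σ {k} ≢k = trans (r≡∑𝟙 H σ k) (∑-zero (allFin (m H)) λ a → 𝟙-false (minPos H σ (edge H a) ≟ k) (≢k a))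

module _ {H : Hypergraph} (σ : Ordering H) {i j : Fin (n H)} (i₀ : toℕ i ≡ 0) (j>0 : 0 < toℕ j) where

  minPos-transpose : ∀ {e} → Nonempty e →
    minPos H (σ ∘ₚ transpose i j) e + toℕ j * 𝟙 (minPos H σ e ≟ suc (toℕ j))
      ≤ minPos H σ e + toℕ j * 𝟙 (minPos H σ e ≟ 1)
  minPos-transpose {e} e≠∅ with minPos-attained H σ e e≠∅
  ... | w , w∈e , ≡pos-w rewrite ≡pos-w =
    ≤-trans (+-monoˡ-≤ _ (minPos-≤-pos H (σ ∘ₚ transpose i j) e w∈e))
            (≤-reflexive (cong suc (toℕ-transpose-first i₀ j>0 (σ ⟨$⟩ʳ w))))

  cost-transpose : cost H (σ ∘ₚ transpose i j) + toℕ j * r H σ (suc (toℕ j)) ≤ cost H σ + toℕ j * r H σ 1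
  cost-transpose = begin
    cost H σ′ + K * r H σ (suc K)                             ≡⟨ cong (λ x → cost H σ′ + K * x) (r≡∑𝟙 H σ (suc K)) ⟩
    cost H σ′ + K * ∑[ a ∈ edges ] 𝟙 (c a ≟ suc K)            ≡⟨ ∑-+-*ˡ edges K c′ (λ a → 𝟙 (c a ≟ suc K)) ⟨
    ∑[ a ∈ edges ] (c′ a + K * 𝟙 (c a ≟ suc K))               ≤⟨ ∑-mono edges (λ a → minPos-transpose (edge-nonempty H a)) ⟩
    ∑[ a ∈ edges ] (c a + K * 𝟙 (c a ≟ 1))                    ≡⟨ ∑-+-*ˡ edges K c (λ a → 𝟙 (c a ≟ 1)) ⟩
    cost H σ + K * ∑[ a ∈ edges ] 𝟙 (c a ≟ 1)                 ≡⟨ cong (λ x → cost H σ + K * x) (r≡∑𝟙 H σ 1) ⟨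
    cost H σ + K * r H σ 1                                    ∎
    where
      open ≤-Reasoning
      K = toℕ j
      σ′ = σ ∘ₚ transpose i j
      edges = allFin (m H)
      c c′ : Fin (m H) → ℕ
      c a = minPos H σ (edge H a)
      c′ a = minPos H σ′ (edge H a)

r-≤-r₁ : ∀ H σ → IsMSSC H σ → ∀ k → r H σ k ≤ r H σ 1
r-≤-r₁ H σ _ zero = ≤-trans (≤-reflexive (r≡0 H σ λ a → >⇒≢ (minPos-edge-positive H σ a))) z≤n
r-≤-r₁ _ _ _ (suc zero) = ≤-refl
r-≤-r₁ H σ optimal (suc (suc K)) with suc K <? n H
... | no 1+K≮n = ≤-trans (≤-reflexive (r≡0 H σ not-attained)) z≤n
  where
    not-attained : ∀ a → minPos H σ (edge H a) ≢ suc (suc K)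
    not-attained a with minPos-edge-is-position H σ a
    ... | p , ≡1+p = λ ≡2+K → 1+K≮n (subst (_< n H) (suc-injective (trans (sym ≡1+p) ≡2+K)) (toℕ<n p))
... | yes 1+K<n = *-cancelˡ-≤ (suc K) (+-cancelˡ-≤ (cost H σ) _ _ (begin
    cost H σ + suc K * r H σ (suc (suc K))  ≤⟨ +-monoˡ-≤ _ (optimal σ′) ⟩
    cost H σ′ + suc K * r H σ (suc (suc K)) ≤⟨ subst (λ K′ → cost H σ′ + K′ * r H σ (suc K′) ≤ cost H σ + K′ * r H σ 1)
                                                      toℕj≡1+K (cost-transpose {H} σ toℕi≡0 toℕj>0) ⟩
    cost H σ + suc K * r H σ 1              ∎))
  where
    open ≤-Reasoning
    i j : Fin (n H)
    i = fromℕ< (≤-trans (s≤s z≤n) 1+K<n)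
    j = fromℕ< 1+K<n
    toℕi≡0 : toℕ i ≡ 0
    toℕi≡0 = toℕ-fromℕ< _
    toℕj≡1+K : toℕ j ≡ suc K
    toℕj≡1+K = toℕ-fromℕ< 1+K<n
    toℕj>0 : 0 < toℕ j
    toℕj>0 = subst (0 <_) (sym toℕj≡1+K) (s≤s z≤n)
    σ′ = σ ∘ₚ transpose i j

length-allFin : ∀ n → length (allFin n) ≡ n
length-allFin n = length-tabulate {n = n} (λ i → i)

cost-upper-bound : ∀ H σ S → IsMSSC H σ → IsSetCover H S → 2 * cost H σ ≤ m H * suc ∣ S ∣
cost-upper-bound H σ S optimal S-covers = begin
  2 * cost H σ                                     ≤⟨ +-mono-≤ (optimal α) (≤-trans (≤-reflexive (+-identityʳ _)) (optimal β)) ⟩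
  cost H α + cost H β                              ≡⟨ ∑-+ edges (c α) (c β) ⟨
  ∑[ a ∈ edges ] (c α a + c β a)                   ≤⟨ ∑-mono edges pair-≤ ⟩
  ∑[ a ∈ edges ] suc (length L)                    ≡⟨ ∑-const edges (suc (length L)) ⟩
  length edges * suc (length L)                    ≡⟨ cong₂ (λ x y → x * suc y) (length-allFin (m H)) (length-elements S) ⟩
  m H * suc ∣ S ∣                                  ∎
  where
    open ≤-Reasoning
    edges = allFin (m H)
    L = elements S
    α β : Ordering H
    α = moveAllToFront L
    β = moveAllToFront (reverse L)
    c : Ordering H → Fin (m H) → ℕ
    c τ a = minPos H τ (edge H a)
    pair-≤ : ∀ a → c α a + c β a ≤ suc (length L)
    pair-≤ a with S-covers a
    ... | v , v∈S , v∈e = begin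
      c α a + c β a                                 ≤⟨ +-mono-≤ (minPos-≤-pos H α _ v∈e) (minPos-≤-pos H β _ v∈e) ⟩
      suc (toℕ (α ⟨$⟩ʳ v)) + suc (toℕ (β ⟨$⟩ʳ v))   ≡⟨ cong suc (+-suc _ _) ⟩
      suc (suc (toℕ (α ⟨$⟩ʳ v) + toℕ (β ⟨$⟩ʳ v)))   ≤⟨ s≤s (moveAllToFront-reverse (∈-elements v∈S)) ⟩
      suc (length L)                                ∎

cost-lower-bound : ∀ H σ → IsMSSC H σ → ∀ t → 2 * (suc t * m H) ≤ 2 * cost H σ + r H σ 1 * (suc t * t)
cost-lower-bound H σ optimal t =
  subst (λ M → 2 * (suc t * M) ≤ 2 * cost H σ + r H σ 1 * (suc t * t)) (length-allFin (m H))
        (∑-≥-by-levels (allFin (m H)) (λ a → minPos H σ (edge H a)) (minPos-edge-positive H σ)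
                       (λ k → subst (_≤ r H σ 1) (r≡∑𝟙 H σ k) (r-≤-r₁ H σ optimal k)) t)

cost-bounds⇒m≤ρt : ∀ M C ρ t → 2 * (suc t * M) ≤ 2 * C + ρ * (suc t * t) → 2 * C ≤ M * suc t → M ≤ ρ * t
cost-bounds⇒m≤ρt M C ρ t lower upper = *-cancelˡ-≤ (suc t) (+-cancelˡ-≤ (suc t * M) _ _ (begin
  suc t * M + suc t * M              ≡⟨ solve 2 (λ t M → (con 1 :+ t) :* M :+ (con 1 :+ t) :* M := con 2 :* ((con 1 :+ t) :* M)) refl t M ⟩
  2 * (suc t * M)                    ≤⟨ lower ⟩
  2 * C + ρ * (suc t * t)            ≤⟨ +-monoˡ-≤ _ upper ⟩
  M * suc t + ρ * (suc t * t)        ≡⟨ solve 3 (λ t M ρ → M :* (con 1 :+ t) :+ ρ :* ((con 1 :+ t) :* t) := (con 1 :+ t) :* M :+ (con 1 :+ t) :* (ρ :* t)) refl t M ρ ⟩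
  suc t * M + suc t * (ρ * t)        ∎))
  where
    open ≤-Reasoning
    open +-*-Solver

lemma7 : (H : Hypergraph) → m H ≥ 1 → (σ : Ordering H) → IsMSSC H σ →
         (t : ℕ) → IsTau H t → m H ≤ r H σ 1 * t
lemma7 H _ σ optimal t ((S , S-covers , ∣S∣≡t) , _) =
  cost-bounds⇒m≤ρt (m H) (cost H σ) (r H σ 1) t (cost-lower-bound H σ optimal t)
    (subst (λ s → 2 * cost H σ ≤ m H * suc s) ∣S∣≡t (cost-upper-bound H σ S optimal S-covers))
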